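{- Let $b$ and $c$ be positive integers and $\alpha\in S_{bc}^{ -1}\mathbb Z$. Then $D_b(D_c(\alpha))=D_{bc}(\alpha)$. In particular, for every positive integer $n$, the $n$-fold composite $D_b^n$ equals $D_{b^n}$; and if $b^n\ge\mathfrak n_\alpha$, $b^n\equiv1\pmod{d(\alpha)}$ and $\alpha\notin\mathbb Z_{\le0}$, then $D_b^n(\alpha)=\langle\alpha\rangle$.
   Context: For $\alpha\in\mathbb Q$, write $\alpha=n(\alpha)/d(\alpha)$ in lowest terms with $d(\alpha)>0$. For a positive integer $m$, $S_m^{ -1}\mathbb Z$ is the set of rationals $\alpha$ with $\gcd(d(\alpha),m)=1$, and for such $\alpha$, $D_m(\alpha)$ is the unique element of $S_m^{ -1}\mathbb Z$ with $mD_m(\alpha)-\alpha\in\{0,\dots,m-1\}$. $\langle x\rangle$ is the fractional part of $x$ if $x\notin\mathbb Z$ and $1$ if $x\in\mathbb Z$. $\mathfrak n_\alpha:=n(\alpha)$ if $\alpha\ge0$ and $|n(\alpha)|+1$ if $\alpha<0$. -}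

module Defs where

open import Data.Nat as ℕ using (ℕ; zero; suc)
open import Data.Nat.Coprimality using (Coprime; coprime?)
open import Data.Integer as ℤ using (ℤ; +_; -[1+_])
open import Data.Rational as ℚ using (ℚ; ↥_; ↧ₙ_; _+_; _*_; _-_; _/_; floor; 0ℚ; 1ℚ; _≤_)
open import Data.List using (List; filter; upTo)
open import Data.Product using (_×_)
open import Data.Maybe using (maybe′)
open import Relation.Nullary using (¬_; yes; no)
import Data.List as List

d : ℚ → ℕ
d α = ↧ₙ α

-- α ∈ S_m^{-1} ℤ  ⇔  gcd(d(α), m) = 1
InS : ℕ → ℚ → Set
InS m α = Coprime (d α) m

cand : (k : ℕ) → ℚ → ℕ → ℚ
cand k α r = (α + (+ r / 1)) * (+ 1 / suc k)

-- D_m(α): the unique β ∈ S_m^{-1}ℤ with m β - α ∈ {0,…,m-1}.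
-- Equivalently β = (α + r)/m for the (unique) r ∈ {0,…,m-1} with
-- (α + r)/m ∈ S_m^{-1}ℤ; we take the least such r (and junk values
-- when no such r exists, i.e. when α ∉ S_m^{-1}ℤ, or when m = 0).
D : ℕ → ℚ → ℚ
D zero    α = α
D (suc k) α =
  maybe′ (cand k α) α
    (List.head (filter (λ r → coprime? (d (cand k α r)) (suc k)) (upTo (suc k))))

iter : ℕ → (ℚ → ℚ) → ℚ → ℚ
iter zero    f x = x
iter (suc n) f x = f (iter n f x)

IsInt : ℚ → Set
IsInt α = d α ≡ 1
  where open import Relation.Binary.PropositionalEquality using (_≡_)

frac : ℚ → ℚ
frac x with d x ℕ.≟ 1
... | yes _ = 1ℚ
... | no  _ = x - (floor x / 1)

-- 𝔫_α = n(α) if α ≥ 0, |n(α)| + 1 if α < 0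
frakN : ℚ → ℕ
frakN α with ↥ α
... | + k      = k
... | -[1+ k ] = suc (suc k)

-- D_m(α) is characterised by two properties: m·D_m(α) − α is a digit in {0,…,m−1}, and
-- D_m(α) ∈ S_m⁻¹ℤ.  Two such values differ by δ ∈ S_m⁻¹ℤ with m δ an integer of absolute
-- value below m; as d(δ) is prime to m, m divides m δ, so δ = 0.  For α = p/q ∈ S_m⁻¹ℤ a
-- value exists: take the digit r with m ∣ p + q r, which q being invertible mod m allows.
-- If c β = α + r and b γ = β + s with digits r < c and s < b, then b c γ = α + (r + c s) with
-- r + c s < b c; hence D_b ∘ D_c = D_{bc}, and D_b^n = D_{b^n} by induction.
-- Finally let b^n = 1 + w q and p = s + ⌊α⌋ q with 0 < s < q.  Then ⟨α⟩ = α − ⌊α⌋ satisfies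
-- b^n ⟨α⟩ = α + (w s − ⌊α⌋), and q (w s − ⌊α⌋) = b^n s − p lies in [0, q b^n) precisely
-- because −b^n < p ≤ b^n, which is what b^n ≥ 𝔫_α says.  For a positive integer α ≤ b^n,
-- ⟨α⟩ = 1 and the digit is b^n − α.
module Submission where

open import Defs
open import Data.Nat as ℕ using (ℕ; zero; suc; _<_; _≤_; _^_; _%_; _/_; _≥_; z≤n; s≤s)
import Data.Nat.Properties as ℕP
open import Data.Nat.Divisibility
  using (_∣_; divides; ∣-trans; ∣-refl; n∣m*n; m∣m*n; ∣1⇒≡1; ∣m∣n⇒∣m+n; %-presˡ-∣; >⇒∤)
open import Data.Nat.Coprimality as C using (Coprime)
open import Data.Nat.GCD using (module Bézout)
open import Data.Nat.DivMod using (m≡m%n+[m/n]*n; m<n⇒m%n≡m)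
open import Data.Integer as ℤ using (ℤ; +_; -[1+_]; ∣_∣; 0ℤ)
import Data.Integer.Properties as ℤP
import Data.Integer.DivMod as ℤD
open import Data.Integer.Tactic.RingSolver using (solve-∀)
open import Data.Rational as ℚ using (ℚ; mkℚ; ↥_; ↧_; _+_; _*_; _-_; -_; 0ℚ; 1ℚ; toℚᵘ; floor)
import Data.Rational.Properties as ℚP
import Data.Rational.Unnormalised as ℚᵘ
import Data.Rational.Unnormalised.Properties as ℚᵘP
open import Data.Rational.Solver using (module +-*-Solver)
open +-*-Solver using (solve; _:+_; _:*_; _:-_; _:=_; con)
open import Data.List using (List; _∷_; filter; upTo)
import Data.List as List
open import Data.List.Membership.Propositional using (_∈_)
open import Data.List.Membership.Propositional.Properties using (∈-filter⁺; ∈-filter⁻; ∈-upTo⁺; ∈-upTo⁻)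
open import Data.List.Relation.Unary.Any using (here)
open import Data.Maybe using (maybe′)
open import Data.Product using (∃; ∃₂; _×_; _,_; proj₁; proj₂)
open import Relation.Nullary using (¬_; Dec; yes; no; contradiction)
open import Relation.Binary.PropositionalEquality

-- Integers inside ℚ

ι : ℤ → ℚ
ι z = z ℚ./ 1

toℚᵘ-ι : ∀ z → toℚᵘ (ι z) ℚᵘ.≃ ℚᵘ.mkℚᵘ z 0
toℚᵘ-ι z = ℚP.toℚᵘ-fromℚᵘ (ℚᵘ.mkℚᵘ z 0)

ι-homo-+ : ∀ a b → ι (a ℤ.+ b) ≡ ι a + ι b
ι-homo-+ a b = ℚP.toℚᵘ-injective (begin
  toℚᵘ (ι (a ℤ.+ b))            ≈⟨ toℚᵘ-ι (a ℤ.+ b) ⟩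
  ℚᵘ.mkℚᵘ (a ℤ.+ b) 0           ≈⟨ ℚᵘ.*≡* (identity a b) ⟩
  ℚᵘ.mkℚᵘ a 0 ℚᵘ.+ ℚᵘ.mkℚᵘ b 0 ≈⟨ ℚᵘP.+-cong (toℚᵘ-ι a) (toℚᵘ-ι b) ⟨
  toℚᵘ (ι a) ℚᵘ.+ toℚᵘ (ι b)    ≈⟨ ℚP.toℚᵘ-homo-+ (ι a) (ι b) ⟨
  toℚᵘ (ι a + ι b)              ∎)
  where
  open ℚᵘP.≃-Reasoning
  identity : ∀ a b → (a ℤ.+ b) ℤ.* + 1 ≡ (a ℤ.* + 1 ℤ.+ b ℤ.* + 1) ℤ.* + 1
  identity = solve-∀

ι-homo-* : ∀ a b → ι (a ℤ.* b) ≡ ι a * ι b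
ι-homo-* a b = ℚP.toℚᵘ-injective (begin
  toℚᵘ (ι (a ℤ.* b))            ≈⟨ toℚᵘ-ι (a ℤ.* b) ⟩
  ℚᵘ.mkℚᵘ (a ℤ.* b) 0           ≈⟨ ℚᵘP.≃-refl ⟩
  ℚᵘ.mkℚᵘ a 0 ℚᵘ.* ℚᵘ.mkℚᵘ b 0 ≈⟨ ℚᵘP.*-cong (toℚᵘ-ι a) (toℚᵘ-ι b) ⟨
  toℚᵘ (ι a) ℚᵘ.* toℚᵘ (ι b)    ≈⟨ ℚP.toℚᵘ-homo-* (ι a) (ι b) ⟨
  toℚᵘ (ι a * ι b)              ∎)
  where open ℚᵘP.≃-Reasoning

ι-homo‿- : ∀ a → ι (ℤ.- a) ≡ - ι a
ι-homo‿- a = ℚP.toℚᵘ-injective (begin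
  toℚᵘ (ι (ℤ.- a))     ≈⟨ toℚᵘ-ι (ℤ.- a) ⟩
  ℚᵘ.- ℚᵘ.mkℚᵘ a 0     ≈⟨ ℚᵘP.-‿cong (toℚᵘ-ι a) ⟨
  ℚᵘ.- toℚᵘ (ι a)      ≈⟨ ℚP.toℚᵘ-homo‿- (ι a) ⟨
  toℚᵘ (- ι a)         ∎)
  where open ℚᵘP.≃-Reasoning

ι-homo-- : ∀ a b → ι (a ℤ.- b) ≡ ι a - ι b
ι-homo-- a b = trans (ι-homo-+ a (ℤ.- b)) (cong (λ t → ι a + t) (ι-homo‿- b))

ι-injective : ∀ a b → ι a ≡ ι b → a ≡ b
ι-injective a b ιa≡ιb with ℚᵘP.≃-trans (ℚᵘP.≃-sym (toℚᵘ-ι a)) (ℚᵘP.≃-trans (ℚP.toℚᵘ-cong ιa≡ιb) (toℚᵘ-ι b))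
... | ℚᵘ.*≡* eq = trans (sym (ℤP.*-identityʳ a)) (trans eq (ℤP.*-identityʳ b))

ι-pos-+ : ∀ m n → ι (+ (m ℕ.+ n)) ≡ ι (+ m) + ι (+ n)
ι-pos-+ m n = trans (cong ι (ℤP.pos-+ m n)) (ι-homo-+ (+ m) (+ n))

ι-pos-* : ∀ m n → ι (+ (m ℕ.* n)) ≡ ι (+ m) * ι (+ n)
ι-pos-* m n = trans (cong ι (ℤP.pos-* m n)) (ι-homo-* (+ m) (+ n))

↧*≡↥ : ∀ x → ι (↧ x) * x ≡ ι (↥ x)
↧*≡↥ x@(mkℚ n _ _) = ℚP.toℚᵘ-injective (begin
  toℚᵘ (ι (↧ x) * x)                 ≈⟨ ℚP.toℚᵘ-homo-* (ι (↧ x)) x ⟩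
  toℚᵘ (ι (↧ x)) ℚᵘ.* toℚᵘ x         ≈⟨ ℚᵘP.*-congʳ (toℚᵘ-ι (↧ x)) ⟩
  ℚᵘ.mkℚᵘ (↧ x) 0 ℚᵘ.* toℚᵘ x        ≈⟨ ℚᵘ.*≡* (identity (↧ x) n) ⟩
  ℚᵘ.mkℚᵘ n 0                        ≈⟨ toℚᵘ-ι n ⟨
  toℚᵘ (ι n)                         ∎)
  where
  open ℚᵘP.≃-Reasoning
  identity : ∀ e n → (e ℤ.* n) ℤ.* + 1 ≡ n ℤ.* (+ 1 ℤ.* e)
  identity = solve-∀

ι[1+k]*1/[1+k]≡1 : ∀ k → ι (+ suc k) * (+ 1 ℚ./ suc k) ≡ 1ℚ
ι[1+k]*1/[1+k]≡1 k = ℚP.toℚᵘ-injective (begin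
  toℚᵘ (ι (+ suc k) * (+ 1 ℚ./ suc k))                   ≈⟨ ℚP.toℚᵘ-homo-* (ι (+ suc k)) (+ 1 ℚ./ suc k) ⟩
  toℚᵘ (ι (+ suc k)) ℚᵘ.* toℚᵘ (+ 1 ℚ./ suc k)           ≈⟨ ℚᵘP.*-cong (toℚᵘ-ι (+ suc k)) (ℚP.toℚᵘ-fromℚᵘ (ℚᵘ.mkℚᵘ (+ 1) k)) ⟩
  ℚᵘ.mkℚᵘ (+ suc k) 0 ℚᵘ.* ℚᵘ.mkℚᵘ (+ 1) k              ≈⟨ ℚᵘ.*≡* identity ⟩
  ℚᵘ.1ℚᵘ                                                  ∎)
  where
  open ℚᵘP.≃-Reasoning
  identity : (+ suc k ℤ.* + 1) ℤ.* + 1 ≡ + 1 ℤ.* + (1 ℕ.* suc k)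
  identity = trans (ℤP.*-identityʳ _) (trans (ℤP.*-identityʳ _)
               (sym (trans (ℤP.*-identityˡ _) (cong +_ (ℕP.*-identityˡ (suc k))))))

*-cancelˡ-ι : ∀ k {x y} → ι (+ suc k) * x ≡ ι (+ suc k) * y → x ≡ y
*-cancelˡ-ι k {x} {y} mx≡my = begin
  x                  ≡⟨ unscale x ⟨
  m⁻¹ * (ι m * x)    ≡⟨ cong (m⁻¹ *_) mx≡my ⟩
  m⁻¹ * (ι m * y)    ≡⟨ unscale y ⟩
  y                  ∎
  where
  open ≡-Reasoning
  m = + suc k
  m⁻¹ = + 1 ℚ./ suc k
  unscale : ∀ z → m⁻¹ * (ι m * z) ≡ z
  unscale z = begin
    m⁻¹ * (ι m * z)  ≡⟨ solve 3 (λ i m z → i :* (m :* z) := (m :* i) :* z) refl m⁻¹ (ι m) z ⟩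
    (ι m * m⁻¹) * z  ≡⟨ cong (_* z) (ι[1+k]*1/[1+k]≡1 k) ⟩
    1ℚ * z           ≡⟨ ℚP.*-identityˡ z ⟩
    z                ∎

-- Denominators

coprime-∣ˡ : ∀ {a b m} → b ∣ a → Coprime a m → Coprime b m
coprime-∣ˡ b∣a a⊥m (i∣b , i∣m) = a⊥m (∣-trans i∣b b∣a , i∣m)

coprime-∣ʳ : ∀ {a m n} → n ∣ m → Coprime a m → Coprime a n
coprime-∣ʳ n∣m a⊥m (i∣a , i∣n) = a⊥m (i∣a , ∣-trans i∣n n∣m)

coprime-* : ∀ {a b m} → Coprime a m → Coprime b m → Coprime (a ℕ.* b) m
coprime-* {a} {b} a⊥m b⊥m {i} (i∣ab , i∣m) = a⊥m (i∣a , i∣m)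
  where
  i⊥b : Coprime i b
  i⊥b (j∣i , j∣b) = b⊥m (j∣b , ∣-trans j∣i i∣m)
  i∣a : i ∣ a
  i∣a = C.coprime-divisor i⊥b (subst (i ∣_) (ℕP.*-comm a b) i∣ab)

d-coprime-↥ : ∀ x → Coprime (d x) ∣ ↥ x ∣
d-coprime-↥ (mkℚ _ _ c) = C.sym (C.recompute c)

ι-cross : ∀ a b u v x → ι (+ a) * x ≡ ι u → ι (+ b) * x ≡ ι v → a ℕ.* ∣ v ∣ ≡ b ℕ.* ∣ u ∣
ι-cross a b u v x ax≡u bx≡v = begin
  a ℕ.* ∣ v ∣       ≡⟨ ℤP.abs-* (+ a) v ⟨
  ∣ + a ℤ.* v ∣     ≡⟨ cong ∣_∣ (ι-injective (+ a ℤ.* v) (+ b ℤ.* u) ι[av]≡ι[bu]) ⟩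
  ∣ + b ℤ.* u ∣     ≡⟨ ℤP.abs-* (+ b) u ⟩
  b ℕ.* ∣ u ∣       ∎
  where
  open ≡-Reasoning
  A = ι (+ a)
  B = ι (+ b)
  ι[av]≡ι[bu] : ι (+ a ℤ.* v) ≡ ι (+ b ℤ.* u)
  ι[av]≡ι[bu] = begin
    ι (+ a ℤ.* v)  ≡⟨ ι-homo-* (+ a) v ⟩
    A * ι v        ≡⟨ cong (A *_) bx≡v ⟨
    A * (B * x)    ≡⟨ solve 3 (λ a b x → a :* (b :* x) := b :* (a :* x)) refl A B x ⟩
    B * (A * x)    ≡⟨ cong (B *_) ax≡u ⟩
    B * ι u        ≡⟨ ι-homo-* (+ b) u ⟨
    ι (+ b ℤ.* u)  ∎

d-∣ : ∀ e n x → ι (+ e) * x ≡ ι n → d x ∣ e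
d-∣ e n x ex≡n =
  C.coprime-divisor (d-coprime-↥ x) (divides ∣ n ∣ (begin
    ∣ ↥ x ∣ ℕ.* e   ≡⟨ ℕP.*-comm ∣ ↥ x ∣ e ⟩
    e ℕ.* ∣ ↥ x ∣   ≡⟨ ι-cross (d x) e (↥ x) n x (↧*≡↥ x) ex≡n ⟨
    d x ℕ.* ∣ n ∣   ≡⟨ ℕP.*-comm (d x) ∣ n ∣ ⟩
    ∣ n ∣ ℕ.* d x   ∎))
  where open ≡-Reasoning

InS-∣ : ∀ m t x → InS m x → ι (+ m) * x ≡ ι t → m ∣ ∣ t ∣
InS-∣ m t x x∈S mx≡t =
  C.coprime-divisor (C.sym x∈S) (divides ∣ ↥ x ∣ (trans (ι-cross (d x) m (↥ x) t x (↧*≡↥ x) mx≡t) (ℕP.*-comm m ∣ ↥ x ∣)))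

InS-ι : ∀ m z → InS m (ι z)
InS-ι m z (i∣d , _) = ∣1⇒≡1 (∣-trans i∣d (d-∣ 1 z (ι z) (ℚP.*-identityˡ (ι z))))

InS-- : ∀ {m} x y → InS m x → InS m y → InS m (x - y)
InS-- x y x∈S y∈S = coprime-∣ˡ (d-∣ (d x ℕ.* d y) (↧ y ℤ.* ↥ x ℤ.- ↧ x ℤ.* ↥ y) (x - y) clears) (coprime-* x∈S y∈S)
  where
  open ≡-Reasoning
  X = ι (↧ x)
  Y = ι (↧ y)
  clears : ι (↧ x ℤ.* ↧ y) * (x - y) ≡ ι (↧ y ℤ.* ↥ x ℤ.- ↧ x ℤ.* ↥ y)
  clears = begin
    ι (↧ x ℤ.* ↧ y) * (x - y)               ≡⟨ cong (_* (x - y)) (ι-homo-* (↧ x) (↧ y)) ⟩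
    X * Y * (x - y)                         ≡⟨ solve 4 (λ a b u v → a :* b :* (u :- v) := b :* (a :* u) :- a :* (b :* v)) refl X Y x y ⟩
    Y * (X * x) - X * (Y * y)               ≡⟨ cong₂ (λ u v → Y * u - X * v) (↧*≡↥ x) (↧*≡↥ y) ⟩
    Y * ι (↥ x) - X * ι (↥ y)               ≡⟨ cong₂ _-_ (ι-homo-* (↧ y) (↥ x)) (ι-homo-* (↧ x) (↥ y)) ⟨
    ι (↧ y ℤ.* ↥ x) - ι (↧ x ℤ.* ↥ y)       ≡⟨ ι-homo-- (↧ y ℤ.* ↥ x) (↧ x ℤ.* ↥ y) ⟨
    ι (↧ y ℤ.* ↥ x ℤ.- ↧ x ℤ.* ↥ y)         ∎

-- The characterisation of D

-- The paper's definition of D_m(α), as a property of the value β.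
record IsD (m : ℕ) (α β : ℚ) : Set where
  constructor isD
  field
    digit   : ℕ
    digit<m : digit < m
    inS     : InS m β
    shift   : ι (+ m) * β ≡ α + ι (+ digit)

digits-≡ : ∀ {m r r'} → r < m → r' < m → m ∣ ∣ + r ℤ.- + r' ∣ → r ≡ r'
digits-≡ {m} {r} {r'} r<m r'<m m∣r-r' = ℤP.+-injective (ℤP.i-j≡0⇒i≡j (+ r) (+ r') (ℤP.∣i∣≡0⇒i≡0 ∣r-r'∣≡0))
  where
  ∣r-r'∣<m : ∣ + r ℤ.- + r' ∣ < m
  ∣r-r'∣<m = ℕP.≤-<-trans (subst (λ t → ∣ t ∣ ≤ r ℕ.⊔ r') (sym (ℤP.m-n≡m⊖n r r')) (ℤP.∣m⊝n∣≤m⊔n r r'))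
                          (ℕP.⊔-lub r<m r'<m)
  ∣r-r'∣≡0 : ∣ + r ℤ.- + r' ∣ ≡ 0
  ∣r-r'∣≡0 with ∣ + r ℤ.- + r' ∣ ℕP.≟ 0
  ... | yes ≡0 = ≡0
  ... | no ≢0 = contradiction m∣r-r' (>⇒∤ {{ℕ.≢-nonZero ≢0}} ∣r-r'∣<m)

IsD-unique : ∀ {m α β γ} → IsD m α β → IsD m α γ → β ≡ γ
IsD-unique {suc k} {α} {β} {γ} (isD r r<m β∈S mβ) (isD r' r'<m γ∈S mγ) = *-cancelˡ-ι k (begin
  M * β          ≡⟨ mβ ⟩
  α + ι (+ r)    ≡⟨ cong (λ t → α + ι (+ t)) r≡r' ⟩
  α + ι (+ r')   ≡⟨ mγ ⟨
  M * γ          ∎)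
  where
  open ≡-Reasoning
  M = ι (+ suc k)
  m[β-γ] : M * (β - γ) ≡ ι (+ r ℤ.- + r')
  m[β-γ] = begin
    M * (β - γ)                    ≡⟨ solve 3 (λ m b c → m :* (b :- c) := m :* b :- m :* c) refl M β γ ⟩
    M * β - M * γ                  ≡⟨ cong₂ _-_ mβ mγ ⟩
    (α + ι (+ r)) - (α + ι (+ r')) ≡⟨ solve 3 (λ a x y → (a :+ x) :- (a :+ y) := x :- y) refl α (ι (+ r)) (ι (+ r')) ⟩
    ι (+ r) - ι (+ r')             ≡⟨ ι-homo-- (+ r) (+ r') ⟨
    ι (+ r ℤ.- + r')               ∎
  r≡r' : r ≡ r'
  r≡r' = digits-≡ r<m r'<m (InS-∣ (suc k) (+ r ℤ.- + r') (β - γ) (InS-- β γ β∈S γ∈S) m[β-γ])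

ι-*-cand : ∀ k α r → ι (+ suc k) * cand k α r ≡ α + ι (+ r)
ι-*-cand k α r = begin
  M * ((α + ι (+ r)) * m⁻¹) ≡⟨ solve 3 (λ m x i → m :* (x :* i) := (m :* i) :* x) refl M (α + ι (+ r)) m⁻¹ ⟩
  (M * m⁻¹) * (α + ι (+ r)) ≡⟨ cong (_* (α + ι (+ r))) (ι[1+k]*1/[1+k]≡1 k) ⟩
  1ℚ * (α + ι (+ r))        ≡⟨ ℚP.*-identityˡ _ ⟩
  α + ι (+ r)               ∎
  where
  open ≡-Reasoning
  M = ι (+ suc k)
  m⁻¹ = + 1 ℚ./ suc k

maybe′-head : ∀ {A B : Set} {f : A → B} {b x} {xs : List A} →
              x ∈ xs → (∀ {y} → y ∈ xs → f y ≡ b) → ∀ a → maybe′ f a (List.head xs) ≡ b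
maybe′-head {xs = _ ∷ _} _ all≡b _ = all≡b (here refl)

IsD⇒D≡ : ∀ {m α β} → IsD m α β → D m α ≡ β
IsD⇒D≡ {suc k} {α} {β} α↦β@(isD r r<m β∈S mβ) = maybe′-head r∈candidates candidate≡β α
  where
  inS? = λ r → C.coprime? (d (cand k α r)) (suc k)
  candidates = filter inS? (upTo (suc k))
  cand≡β : cand k α r ≡ β
  cand≡β = *-cancelˡ-ι k (trans (ι-*-cand k α r) (sym mβ))
  r∈candidates : r ∈ candidates
  r∈candidates = ∈-filter⁺ inS? (∈-upTo⁺ r<m) (subst (InS (suc k)) (sym cand≡β) β∈S)
  candidate≡β : ∀ {y} → y ∈ candidates → cand k α y ≡ β
  candidate≡β {y} y∈ with ∈-filter⁻ inS? {xs = upTo (suc k)} y∈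
  ... | y∈upTo , cand∈S = IsD-unique (isD y (∈-upTo⁻ y∈upTo) cand∈S (ι-*-cand k α y)) α↦β

-- Existence and composition

bézout-ℤ : ∀ {q m} → Coprime q m → ∃₂ λ X Y → X ℤ.* + q ≡ + 1 ℤ.+ Y ℤ.* + m
bézout-ℤ {q} {m} q⊥m with C.coprime-Bézout q⊥m
... | Bézout.+- x y eq = + x , + y , (begin
  + x ℤ.* + q        ≡⟨ ℤP.pos-* x q ⟨
  + (x ℕ.* q)        ≡⟨ cong +_ eq ⟨
  + (1 ℕ.+ y ℕ.* m)  ≡⟨ cong (λ t → + 1 ℤ.+ t) (ℤP.pos-* y m) ⟩
  + 1 ℤ.+ + y ℤ.* + m ∎)
  where open ≡-Reasoning
... | Bézout.-+ x y eq = ℤ.- + x , ℤ.- + y , (begin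
  ℤ.- + x ℤ.* + q                   ≡⟨ identity (+ x) (+ q) ⟩
  + 1 ℤ.- (+ 1 ℤ.+ + x ℤ.* + q)     ≡⟨ cong (λ t → + 1 ℤ.- (+ 1 ℤ.+ t)) (ℤP.pos-* x q) ⟨
  + 1 ℤ.- + (1 ℕ.+ x ℕ.* q)         ≡⟨ cong (λ t → + 1 ℤ.- + t) eq ⟩
  + 1 ℤ.- + (y ℕ.* m)               ≡⟨ cong (λ t → + 1 ℤ.- t) (ℤP.pos-* y m) ⟩
  + 1 ℤ.- + y ℤ.* + m               ≡⟨ identity′ (+ y) (+ m) ⟩
  + 1 ℤ.+ ℤ.- + y ℤ.* + m           ∎)
  where
  open ≡-Reasoning
  identity : ∀ x q → ℤ.- x ℤ.* q ≡ + 1 ℤ.- (+ 1 ℤ.+ x ℤ.* q)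
  identity = solve-∀
  identity′ : ∀ y m → + 1 ℤ.- y ℤ.* m ≡ + 1 ℤ.+ ℤ.- y ℤ.* m
  identity′ = solve-∀

-- r is the residue of −p·q⁻¹ modulo m.
digit-making-multiple : ∀ {q m} .{{_ : ℕ.NonZero m}} → Coprime q m → ∀ p →
                        ∃₂ λ r K → r < m × p ℤ.+ + q ℤ.* + r ≡ K ℤ.* + m
digit-making-multiple {q} {m} q⊥m p with bézout-ℤ q⊥m
... | X , Y , Xq≡1+Ym = r , ℤ.- (p ℤ.* Y) ℤ.- + q ℤ.* j , ℤD.n%ℕd<d z m , (begin
  p ℤ.+ + q ℤ.* + r                                      ≡⟨ cong (λ t → p ℤ.+ + q ℤ.* t) +r≡z-jm ⟩
  p ℤ.+ + q ℤ.* (ℤ.- (p ℤ.* X) ℤ.- j ℤ.* + m)            ≡⟨ identity p (+ q) X j (+ m) ⟩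
  p ℤ.- p ℤ.* (X ℤ.* + q) ℤ.- + q ℤ.* j ℤ.* + m          ≡⟨ cong (λ t → p ℤ.- p ℤ.* t ℤ.- + q ℤ.* j ℤ.* + m) Xq≡1+Ym ⟩
  p ℤ.- p ℤ.* (+ 1 ℤ.+ Y ℤ.* + m) ℤ.- + q ℤ.* j ℤ.* + m  ≡⟨ identity′ p (+ q) Y j (+ m) ⟩
  (ℤ.- (p ℤ.* Y) ℤ.- + q ℤ.* j) ℤ.* + m                  ∎)
  where
  open ≡-Reasoning
  z = ℤ.- (p ℤ.* X)
  r = z ℤD.%ℕ m
  j = z ℤD./ℕ m
  +r≡z-jm : + r ≡ z ℤ.- j ℤ.* + m
  +r≡z-jm = begin
    + r                              ≡⟨ ℤP.+-identityʳ (+ r) ⟨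
    + r ℤ.+ 0ℤ                       ≡⟨ cong (λ t → + r ℤ.+ t) (ℤP.+-inverseʳ (j ℤ.* + m)) ⟨
    + r ℤ.+ (j ℤ.* + m ℤ.- j ℤ.* + m) ≡⟨ ℤP.+-assoc (+ r) (j ℤ.* + m) _ ⟨
    + r ℤ.+ j ℤ.* + m ℤ.- j ℤ.* + m  ≡⟨ cong (ℤ._- j ℤ.* + m) (ℤD.a≡a%ℕn+[a/ℕn]*n z m) ⟨
    z ℤ.- j ℤ.* + m                  ∎
  identity : ∀ p q X j m → p ℤ.+ q ℤ.* (ℤ.- (p ℤ.* X) ℤ.- j ℤ.* m) ≡ p ℤ.- p ℤ.* (X ℤ.* q) ℤ.- q ℤ.* j ℤ.* m
  identity = solve-∀
  identity′ : ∀ p q Y j m → p ℤ.- p ℤ.* (+ 1 ℤ.+ Y ℤ.* m) ℤ.- q ℤ.* j ℤ.* m ≡ (ℤ.- (p ℤ.* Y) ℤ.- q ℤ.* j) ℤ.* m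
  identity′ = solve-∀

IsD-of-multiple : ∀ k α r K → r < suc k → InS (suc k) α → ↥ α ℤ.+ ↧ α ℤ.* + r ≡ K ℤ.* + suc k →
                  IsD (suc k) α (cand k α r) × d (cand k α r) ∣ d α
IsD-of-multiple k α r K r<m α∈S p+qr≡Km = isD r r<m (coprime-∣ˡ dβ∣dα α∈S) (ι-*-cand k α r) , dβ∣dα
  where
  open ≡-Reasoning
  β = cand k α r
  M = ι (+ suc k)
  Q = ι (↧ α)
  qβ≡K : Q * β ≡ ι K
  qβ≡K = *-cancelˡ-ι k (begin
    M * (Q * β)                    ≡⟨ solve 3 (λ m q b → m :* (q :* b) := q :* (m :* b)) refl M Q β ⟩
    Q * (M * β)                    ≡⟨ cong (Q *_) (ι-*-cand k α r) ⟩
    Q * (α + ι (+ r))              ≡⟨ solve 3 (λ q a r → q :* (a :+ r) := q :* a :+ q :* r) refl Q α (ι (+ r)) ⟩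
    Q * α + Q * ι (+ r)            ≡⟨ cong₂ _+_ (↧*≡↥ α) (sym (ι-homo-* (↧ α) (+ r))) ⟩
    ι (↥ α) + ι (↧ α ℤ.* + r)      ≡⟨ ι-homo-+ (↥ α) (↧ α ℤ.* + r) ⟨
    ι (↥ α ℤ.+ ↧ α ℤ.* + r)        ≡⟨ cong ι p+qr≡Km ⟩
    ι (K ℤ.* + suc k)              ≡⟨ ι-homo-* K (+ suc k) ⟩
    ι K * M                        ≡⟨ ℚP.*-comm (ι K) M ⟩
    M * ι K                        ∎)
  dβ∣dα : d β ∣ d α
  dβ∣dα = d-∣ (d α) K β qβ≡K

IsD-exists : ∀ {m} α → 0 < m → InS m α → ∃ λ β → IsD m α β × d β ∣ d α
IsD-exists {suc k} α _ α∈S =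
  let r , K , r<m , p+qr≡Km = digit-making-multiple α∈S (↥ α)
  in cand k α r , IsD-of-multiple k α r K r<m α∈S p+qr≡Km

digit-combine< : ∀ {b c r s} → r < c → s < b → r ℕ.+ c ℕ.* s < b ℕ.* c
digit-combine< {b} {c} {r} {s} r<c s<b = begin-strict
  r ℕ.+ c ℕ.* s  <⟨ ℕP.+-monoˡ-< (c ℕ.* s) r<c ⟩
  c ℕ.+ c ℕ.* s  ≡⟨ ℕP.*-suc c s ⟨
  c ℕ.* suc s    ≤⟨ ℕP.*-monoʳ-≤ c s<b ⟩
  c ℕ.* b        ≡⟨ ℕP.*-comm c b ⟩
  b ℕ.* c        ∎
  where open ℕP.≤-Reasoning

IsD-∘ : ∀ {b c α β γ} → IsD c α β → IsD b β γ → InS (b ℕ.* c) γ → IsD (b ℕ.* c) α γ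
IsD-∘ {b} {c} {α} {β} {γ} (isD r r<c _ cβ) (isD s s<b _ bγ) γ∈S =
  isD (r ℕ.+ c ℕ.* s) (digit-combine< r<c s<b) γ∈S (begin
    ι (+ (b ℕ.* c)) * γ               ≡⟨ cong (_* γ) (ι-pos-* b c) ⟩
    B * C * γ                         ≡⟨ solve 3 (λ b c g → b :* c :* g := c :* (b :* g)) refl B C γ ⟩
    C * (B * γ)                       ≡⟨ cong (C *_) bγ ⟩
    C * (β + S)                       ≡⟨ solve 3 (λ c b s → c :* (b :+ s) := c :* b :+ c :* s) refl C β S ⟩
    C * β + C * S                     ≡⟨ cong₂ _+_ cβ (sym (ι-pos-* c s)) ⟩
    α + ι (+ r) + ι (+ (c ℕ.* s))     ≡⟨ ℚP.+-assoc α (ι (+ r)) (ι (+ (c ℕ.* s))) ⟩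
    α + (ι (+ r) + ι (+ (c ℕ.* s)))   ≡⟨ cong (λ t → α + t) (ι-pos-+ r (c ℕ.* s)) ⟨
    α + ι (+ (r ℕ.+ c ℕ.* s))         ∎)
  where
  open ≡-Reasoning
  B = ι (+ b)
  C = ι (+ c)
  S = ι (+ s)

IsD-1 : ∀ α → IsD 1 α α
IsD-1 α = isD 0 (s≤s z≤n) (C.sym (C.1-coprimeTo (d α))) (trans (ℚP.*-identityˡ α) (sym (ℚP.+-identityʳ α)))

D∘D≡D* : (b c : ℕ) → 0 < b → 0 < c → (α : ℚ) → InS (b ℕ.* c) α → D b (D c α) ≡ D (b ℕ.* c) α
D∘D≡D* b c 0<b 0<c α α∈S =
  let β , α↦β , dβ∣dα = IsD-exists α 0<c (coprime-∣ʳ (n∣m*n b) α∈S)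
      γ , β↦γ , dγ∣dβ = IsD-exists β 0<b (coprime-∣ˡ dβ∣dα (coprime-∣ʳ (m∣m*n c) α∈S))
  in begin
    D b (D c α)     ≡⟨ cong (D b) (IsD⇒D≡ α↦β) ⟩
    D b β           ≡⟨ IsD⇒D≡ β↦γ ⟩
    γ               ≡⟨ IsD⇒D≡ (IsD-∘ α↦β β↦γ (coprime-∣ˡ (∣-trans dγ∣dβ dβ∣dα) α∈S)) ⟨
    D (b ℕ.* c) α   ∎
  where open ≡-Reasoning

iter-D≡D^ : (b n : ℕ) → 0 < b → 0 < n → (α : ℚ) → InS (b ^ n) α → iter n (D b) α ≡ D (b ^ n) α
iter-D≡D^ b n 0<b _ α = go n
  where
  go : ∀ n → InS (b ^ n) α → iter n (D b) α ≡ D (b ^ n) α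
  go zero    _   = sym (IsD⇒D≡ (IsD-1 α))
  go (suc n) α∈S = trans (cong (D b) (go n (coprime-∣ʳ (n∣m*n b) α∈S)))
                         (D∘D≡D* b (b ^ n) 0<b (ℕP.m^n>0 b {{ℕ.>-nonZero 0<b}} n) α α∈S)

-- Fractional parts

%≡1%⇒coprime : ∀ {m q} .{{_ : ℕ.NonZero q}} → m % q ≡ 1 % q → Coprime q m
%≡1%⇒coprime {m} {q} m≡1 {i} (i∣q , i∣m) =
  ∣1⇒≡1 (subst (i ∣_) (sym (m≡m%n+[m/n]*n 1 q)) (∣m∣n⇒∣m+n i∣1%q (∣-trans i∣q (n∣m*n (1 / q)))))
  where
  i∣1%q : i ∣ 1 % q
  i∣1%q = subst (i ∣_) m≡1 (%-presˡ-∣ i∣m i∣q)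

%≡1%⇒≡1+* : ∀ {m q} .{{_ : ℕ.NonZero q}} → 1 < q → m % q ≡ 1 % q → m ≡ suc (m / q ℕ.* q)
%≡1%⇒≡1+* {m} {q} 1<q m≡1 = trans (m≡m%n+[m/n]*n m q) (cong (ℕ._+ m / q ℕ.* q) (trans m≡1 (m<n⇒m%n≡m 1<q)))

IsD-ι : ∀ {m n} → 0 < n → n ≤ m → IsD m (ι (+ n)) 1ℚ
IsD-ι {m} {n} 0<n n≤m = isD (m ℕ.∸ n) (ℕP.∸-monoʳ-< 0<n n≤m) (C.1-coprimeTo m) (begin
  ι (+ m) * 1ℚ                 ≡⟨ ℚP.*-identityʳ (ι (+ m)) ⟩
  ι (+ m)                      ≡⟨ cong (λ t → ι (+ t)) (ℕP.m+[n∸m]≡n n≤m) ⟨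
  ι (+ (n ℕ.+ (m ℕ.∸ n)))      ≡⟨ ι-pos-+ n (m ℕ.∸ n) ⟩
  ι (+ n) + ι (+ (m ℕ.∸ n))    ∎)
  where open ≡-Reasoning

IsD-frac-integer : ∀ {m} α → IsInt α → ¬ (IsInt α × α ℚ.≤ 0ℚ) → frakN α ≤ m → IsD m α (frac α)
IsD-frac-integer α@(mkℚ (+ suc n) _ _) refl _ 𝔫≤m =
  subst (λ x → IsD _ x 1ℚ) (ℚP.↥p/↧p≡p α) (IsD-ι (s≤s z≤n) 𝔫≤m)
IsD-frac-integer (mkℚ (+ 0) _ _) refl α≰0 _ = contradiction (refl , ℚ.*≤* (ℤ.+≤+ z≤n)) α≰0
IsD-frac-integer (mkℚ -[1+ _ ] _ _) refl α≰0 _ = contradiction (refl , ℚ.*≤* ℤ.-≤+) α≰0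

frac-nonInteger : ∀ α → ¬ IsInt α → frac α ≡ α - ι (floor α)
frac-nonInteger α α∉ℤ with d α ℕ.≟ 1
... | yes α∈ℤ = contradiction α∈ℤ α∉ℤ
... | no _    = refl

floor-division : ∀ α → ↥ α ≡ + (↥ α ℤ.% ↧ α) ℤ.+ floor α ℤ.* ↧ α
floor-division (mkℚ n e _) = ℤD.a≡a%n+[a/n]*n n (+ suc e)

remainder<d : ∀ α → ↥ α ℤ.% ↧ α < d α
remainder<d (mkℚ n e _) = ℤD.n%d<d n (+ suc e)

0<remainder : ∀ α → ¬ IsInt α → 0 < ↥ α ℤ.% ↧ α
0<remainder α α∉ℤ = ℕP.n≢0⇒n>0 λ s≡0 → α∉ℤ (d-coprime-↥ α (∣-refl , divides ∣ floor α ∣ (begin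
  ∣ ↥ α ∣                                   ≡⟨ cong ∣_∣ (floor-division α) ⟩
  ∣ + (↥ α ℤ.% ↧ α) ℤ.+ floor α ℤ.* ↧ α ∣  ≡⟨ cong (λ s → ∣ + s ℤ.+ floor α ℤ.* ↧ α ∣) s≡0 ⟩
  ∣ 0ℤ ℤ.+ floor α ℤ.* ↧ α ∣               ≡⟨ cong ∣_∣ (ℤP.+-identityˡ (floor α ℤ.* ↧ α)) ⟩
  ∣ floor α ℤ.* ↧ α ∣                       ≡⟨ ℤP.abs-* (floor α) (↧ α) ⟩
  ∣ floor α ∣ ℕ.* d α                       ∎)))
  where open ≡-Reasoning

frakN-bounds : ∀ α {n} → frakN α ≤ suc n → -[1+ n ] ℤ.< ↥ α × ↥ α ℤ.≤ + suc n
frakN-bounds (mkℚ (+ k) _ _)    k≤1+n       = ℤ.-<+ , ℤ.+≤+ k≤1+n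
frakN-bounds (mkℚ -[1+ k ] _ _) (s≤s k<n)  = ℤ.-<- k<n , ℤ.-≤+

fractional-digit-bounds : ∀ {m q s p r} → 0 < s → s < q → + q ℤ.* r ≡ + (m ℕ.* s) ℤ.- p →
                          ℤ.- + m ℤ.< p → p ℤ.≤ + m → 0ℤ ℤ.≤ r × r ℤ.< + m
fractional-digit-bounds {m} {q@(suc _)} {s@(suc _)} {p} {r} 0<s s<q qr≡ms-p -m<p p≤m =
  ℤP.*-cancelˡ-≤-pos 0ℤ r (+ q) (subst (ℤ._≤ + q ℤ.* r) (sym (ℤP.*-zeroʳ (+ q))) 0≤qr) ,
  ℤP.*-cancelˡ-<-nonNeg (+ q) qr<qm
  where
  0≤qr : 0ℤ ℤ.≤ + q ℤ.* r
  0≤qr = subst (0ℤ ℤ.≤_) (sym qr≡ms-p) (ℤP.i≤j⇒0≤j-i (ℤP.≤-trans p≤m (ℤ.+≤+ (ℕP.m≤m*n m s))))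
  -p<m : ℤ.- p ℤ.< + m
  -p<m = subst (ℤ.- p ℤ.<_) (ℤP.neg-involutive (+ m)) (ℤP.neg-mono-< -m<p)
  qr<qm : + q ℤ.* r ℤ.< + q ℤ.* + m
  qr<qm = begin-strict
    + q ℤ.* r                ≡⟨ qr≡ms-p ⟩
    + (m ℕ.* s) ℤ.- p        <⟨ ℤP.+-monoʳ-< (+ (m ℕ.* s)) -p<m ⟩
    + (m ℕ.* s ℕ.+ m)        ≡⟨ cong +_ (trans (ℕP.+-comm (m ℕ.* s) m) (sym (ℕP.*-suc m s))) ⟩
    + (m ℕ.* suc s)          ≤⟨ ℤ.+≤+ (ℕP.*-monoʳ-≤ m s<q) ⟩
    + (m ℕ.* q)              ≡⟨ cong +_ (ℕP.*-comm m q) ⟩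
    + (q ℕ.* m)              ≡⟨ ℤP.pos-* q m ⟩
    + q ℤ.* + m              ∎
    where open ℤP.≤-Reasoning

IsD-frac-nonInteger : ∀ w α → ¬ IsInt α → frakN α ≤ suc (w ℕ.* d α) → InS (suc (w ℕ.* d α)) α →
                      IsD (suc (w ℕ.* d α)) α (frac α)
IsD-frac-nonInteger w α α∉ℤ 𝔫≤m α∈S =
  subst (IsD m α) (sym (frac-nonInteger α α∉ℤ)) (isD ∣ r ∣ ∣r∣<m (InS-- α F α∈S (InS-ι m fl)) shift)
  where
  open ≡-Reasoning
  q = d α
  m = suc (w ℕ.* q)
  fl = floor α
  s = ↥ α ℤ.% ↧ α
  r = + w ℤ.* + s ℤ.- fl
  W = ι (+ w)
  Q = ι (+ q)
  S = ι (+ s)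
  F = ι fl
  identity : ∀ q w s f → q ℤ.* (w ℤ.* s ℤ.- f) ≡ (+ 1 ℤ.+ w ℤ.* q) ℤ.* s ℤ.- (s ℤ.+ f ℤ.* q)
  identity = solve-∀
  qr≡ms-p : + q ℤ.* r ≡ + (m ℕ.* s) ℤ.- ↥ α
  qr≡ms-p = begin
    + q ℤ.* r                                                ≡⟨ identity (+ q) (+ w) (+ s) fl ⟩
    (+ 1 ℤ.+ + w ℤ.* + q) ℤ.* + s ℤ.- (+ s ℤ.+ fl ℤ.* + q)  ≡⟨ cong₂ (λ t u → (+ 1 ℤ.+ t) ℤ.* + s ℤ.- u) (ℤP.pos-* w q) (floor-division α) ⟨
    + m ℤ.* + s ℤ.- ↥ α                                      ≡⟨ cong (ℤ._- ↥ α) (ℤP.pos-* m s) ⟨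
    + (m ℕ.* s) ℤ.- ↥ α                                      ∎
  bounds = fractional-digit-bounds {m} {q} {s} (0<remainder α α∉ℤ) (remainder<d α) qr≡ms-p
             (proj₁ (frakN-bounds α 𝔫≤m)) (proj₂ (frakN-bounds α 𝔫≤m))
  +∣r∣≡r : + ∣ r ∣ ≡ r
  +∣r∣≡r = ℤP.0≤i⇒+∣i∣≡i (proj₁ bounds)
  ∣r∣<m : ∣ r ∣ < m
  ∣r∣<m = ℤP.drop‿+<+ (subst (ℤ._< + m) (sym +∣r∣≡r) (proj₂ bounds))
  qα≡s+fq : Q * α ≡ S + F * Q
  qα≡s+fq = begin
    Q * α                        ≡⟨ ↧*≡↥ α ⟩
    ι (↥ α)                      ≡⟨ cong ι (floor-division α) ⟩
    ι (+ s ℤ.+ fl ℤ.* + q)       ≡⟨ ι-homo-+ (+ s) (fl ℤ.* + q) ⟩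
    S + ι (fl ℤ.* + q)           ≡⟨ cong (λ t → S + t) (ι-homo-* fl (+ q)) ⟩
    S + F * Q                    ∎
  ιr≡ws-f : ι r ≡ W * S - F
  ιr≡ws-f = trans (ι-homo-- (+ w ℤ.* + s) fl) (cong (_- F) (ι-homo-* (+ w) (+ s)))
  shift : ι (+ m) * (α - F) ≡ α + ι (+ ∣ r ∣)
  shift = begin
    ι (+ m) * (α - F)                     ≡⟨ cong (_* (α - F)) (trans (ι-pos-+ 1 (w ℕ.* q)) (cong (λ t → 1ℚ + t) (ι-pos-* w q))) ⟩
    (1ℚ + W * Q) * (α - F)                ≡⟨ solve 4 (λ a f q w → (con 1ℚ :+ w :* q) :* (a :- f) := a :- f :+ w :* (q :* a) :- w :* q :* f) refl α F Q W ⟩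
    α - F + W * (Q * α) - W * Q * F       ≡⟨ cong (λ t → α - F + W * t - W * Q * F) qα≡s+fq ⟩
    α - F + W * (S + F * Q) - W * Q * F   ≡⟨ solve 5 (λ a f s q w → a :- f :+ w :* (s :+ f :* q) :- w :* q :* f := a :+ (w :* s :- f)) refl α F S Q W ⟩
    α + (W * S - F)                       ≡⟨ cong (λ t → α + t) ιr≡ws-f ⟨
    α + ι r                               ≡⟨ cong (λ t → α + ι t) +∣r∣≡r ⟨
    α + ι (+ ∣ r ∣)                       ∎

IsD-frac : ∀ {m} α → frakN α ≤ m → m % d α ≡ 1 % d α → ¬ (IsInt α × α ℚ.≤ 0ℚ) → IsD m α (frac α)
IsD-frac {m} α 𝔫≤m m≡1 α≰0 = by-cases (d α ℕ.≟ 1)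
  where
  by-cases : Dec (IsInt α) → IsD m α (frac α)
  by-cases (yes α∈ℤ) = IsD-frac-integer α α∈ℤ α≰0 𝔫≤m
  by-cases (no α∉ℤ)  = subst (λ n → IsD n α (frac α)) (sym m≡1+wq)
                         (IsD-frac-nonInteger w α α∉ℤ (subst (frakN α ≤_) m≡1+wq 𝔫≤m)
                           (subst (λ n → InS n α) m≡1+wq (%≡1%⇒coprime m≡1)))
    where
    w = m / d α
    m≡1+wq : m ≡ suc (w ℕ.* d α)
    m≡1+wq = %≡1%⇒≡1+* (ℕP.≤∧≢⇒< (s≤s z≤n) (λ 1≡q → α∉ℤ (sym 1≡q))) m≡1

iter-D≡frac : (b n : ℕ) → 0 < b → 0 < n → (α : ℚ) → b ^ n ≥ frakN α → b ^ n % d α ≡ 1 % d α →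
              ¬ (IsInt α × α ℚ.≤ 0ℚ) → iter n (D b) α ≡ frac α
iter-D≡frac b n 0<b 0<n α 𝔫≤bⁿ bⁿ≡1 α≰0 =
  trans (iter-D≡D^ b n 0<b 0<n α (%≡1%⇒coprime bⁿ≡1)) (IsD⇒D≡ (IsD-frac α 𝔫≤bⁿ bⁿ≡1 α≰0))

proposition3p5 :
    ((b c : ℕ) → 0 < b → 0 < c → (α : ℚ) → InS (b ℕ.* c) α →
      D b (D c α) ≡ D (b ℕ.* c) α)
    × ((b n : ℕ) → 0 < b → 0 < n → (α : ℚ) → InS (b ^ n) α →
      iter n (D b) α ≡ D (b ^ n) α)
    × ((b n : ℕ) → 0 < b → 0 < n → (α : ℚ) →
      b ^ n ≥ frakN α → b ^ n % d α ≡ 1 % d α → ¬ (IsInt α × α ℚ.≤ 0ℚ) →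
      iter n (D b) α ≡ frac α)
proposition3p5 = D∘D≡D* , iter-D≡D^ , iter-D≡frac
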